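{- Let $\mathcal D=(T,\chi)$ be a loose tree-decomposition of a graph $G$, and for $x\in V(G)$ let $T_x$ be the subtree of $T$ induced by $\{t: x\in\chi(t)\}$. Let $\chi':V(T)\to2^{V(G)}$ be such that for every $x\in V(G)$, the set $\{t\in V(T): x\in\chi'(t)\}$ induces a connected subtree $T'_x$ of $T$ and $T_x$ is a subtree of $T'_x$. Then $(T,\chi')$ is a loose tree-decomposition of $G$.
   Context: Graphs are finite and simple. A loose tree-decomposition of $G$ is a pair $(T,\chi)$, $T$ a tree, $\chi:V(T)\to2^{V(G)}$, such that (L1) for each $x\in V(G)$ the nodes $t$ with $x\in\chi(t)$ induce a nonempty connected subtree of $T$; (L2) for every edge $xy\in E(G)$ there is a tree edge $t_1t_2$ with $xy\in E(G[\chi(t_1)\cup\chi(t_2)])$; (L3) for every tree edge $t_1t_2$, $|E(G[\chi(t_1)\cup\chi(t_2)])\setminus(E(G[\chi(t_1)])\cup E(G[\chi(t_2)]))|\le1$. -}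

module Defs where

open import Data.Nat using (ℕ; _≥_)
open import Data.Fin using (Fin)
open import Data.Fin.Subset using (Subset; _∈_; _∉_; _∪_)
open import Data.List using (List; _∷_; _∷ʳ_; length)
open import Data.List.Relation.Unary.All using (All)
open import Data.List.Relation.Unary.Linked using (Linked)
open import Data.List.Relation.Unary.Unique.Propositional using (Unique)
open import Data.Product using (Σ; ∃; ∃-syntax; _×_)
open import Data.Sum using (_⊎_)
open import Relation.Binary.PropositionalEquality using (_≡_)
open import Relation.Nullary using (¬_)

record Graph (n : ℕ) : Set₁ where
  field
    Adj    : Fin n → Fin n → Set
    sym    : ∀ {x y} → Adj x y → Adj y x
    irrefl : ∀ {x} → ¬ Adj x x
open Graph public

data Walk {n : ℕ} (G : Graph n) (S : Fin n → Set) : Fin n → Fin n → Set where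
  here : ∀ {t} → S t → Walk G S t t
  step : ∀ {t u v} → S t → Adj G t u → Walk G S u v → Walk G S t v

InducesConnected : {n : ℕ} → Graph n → (Fin n → Set) → Set
InducesConnected G S = ∀ t t' → S t → S t' → Walk G S t t'

HasCycle : {n : ℕ} → Graph n → Set
HasCycle G = Σ (Fin _) λ v → Σ (Fin _) λ w → Σ (List (Fin _)) λ vs →
  length vs ≥ 1 × Unique (v ∷ (vs ∷ʳ w)) × Linked (Adj G) (v ∷ (vs ∷ʳ w)) × Adj G w v

record IsTree {m : ℕ} (T : Graph m) : Set where
  field
    nonempty  : Fin m
    connected : InducesConnected T (λ _ → Fin m)
    acyclic   : ¬ HasCycle T

CrossEdge : {n : ℕ} → Graph n → Subset n → Subset n → Fin n → Fin n → Set
CrossEdge G A B x y =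
  Adj G x y × x ∈ (A ∪ B) × y ∈ (A ∪ B) × ¬ (x ∈ A × y ∈ A) × ¬ (x ∈ B × y ∈ B)

record IsLooseTD {n m : ℕ} (G : Graph n) (T : Graph m) (χ : Fin m → Subset n) : Set where
  field
    tree : IsTree T
    L1-nonempty  : ∀ x → ∃[ t ] x ∈ χ t
    L1-connected : ∀ x → InducesConnected T (λ t → x ∈ χ t)
    L2 : ∀ x y → Adj G x y →
         ∃[ t₁ ] ∃[ t₂ ] (Adj T t₁ t₂ × x ∈ (χ t₁ ∪ χ t₂) × y ∈ (χ t₁ ∪ χ t₂))
    -- (L3): at most one such edge (edges as unordered pairs)
    L3 : ∀ t₁ t₂ → Adj T t₁ t₂ → ∀ x y x' y' →
         CrossEdge G (χ t₁) (χ t₂) x y → CrossEdge G (χ t₁) (χ t₂) x' y' →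
         (x ≡ x' × y ≡ y') ⊎ (x ≡ y' × y ≡ x')

-- If xy is a cross edge of (T,χ') at the tree edge t₁t₂, say x ∈ χ'(t₁) ∖ χ'(t₂) and
-- y ∈ χ'(t₂) ∖ χ'(t₁), then the subtree T'ₓ lies in the component of T − t₁t₂ containing
-- t₁ and T'ᵧ in the one containing t₂.  The tree edge witnessing (L2) for xy in (T,χ) has a
-- χ-bag containing x and a χ-bag containing y, i.e. nodes of T'ₓ and T'ᵧ, so it must be
-- t₁t₂ itself with x ∈ χ(t₁) and y ∈ χ(t₂).  Thus every χ'-cross edge at t₁t₂ is a χ-cross
-- edge there and (L3) is inherited; (L1) and (L2) only need χ ⊆ χ'.
module Submission where

open import Defs
open import Level using (_⊔_)
open import Data.Nat using (ℕ; s≤s; z≤n)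
open import Data.Fin using (Fin; _≟_)
open import Data.Fin.Subset using (Subset; _∈_; _∉_; _∪_; _⊆_)
open import Data.Fin.Subset.Properties using (x∈p∪q⁻; x∈p∪q⁺)
open import Data.List using (List; []; _∷_; _∷ʳ_; last; initLast; _∷ʳ′_)
open import Data.List.Membership.Propositional using () renaming (_∈_ to _∈ₗ_)
import Data.List.Membership.DecPropositional as DecMembership
open import Data.List.Relation.Unary.Any using (here; there)
open import Data.List.Relation.Unary.All as All using ()
open import Data.List.Relation.Unary.All.Properties using (¬Any⇒All¬)
open import Data.List.Relation.Unary.AllPairs using ([]; _∷_)
open import Data.List.Relation.Unary.Linked as Linked using (Linked; [-]; _∷_)
open import Data.List.Relation.Unary.Unique.Propositional using (Unique)
open import Data.Maybe using (just)
open import Data.Maybe.Properties using (just-injective)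
open import Data.Product using (∃-syntax; _×_; _,_; proj₁; proj₂; swap)
open import Data.Sum using (_⊎_; inj₁; inj₂)
open import Data.Empty using (⊥; ⊥-elim)
open import Function using (_∘_)
open import Relation.Binary using (Rel; DecidableEquality)
open import Relation.Binary.Construct.Closure.ReflexiveTransitive using (Star; ε; _◅_; _◅◅_)
open import Relation.Binary.PropositionalEquality using (_≡_; refl; trans; subst) renaming (sym to ≡-sym)
open import Relation.Nullary using (¬_; yes; no)
open import Relation.Unary using (Pred)

record SimplePath {a ℓ} {A : Set a} (R : Rel A ℓ) (s t : A) : Set (a ⊔ ℓ) where
  constructor path
  field
    vertices : List A
    linked   : Linked R (s ∷ vertices)
    unique   : Unique (s ∷ vertices)
    ends     : last (s ∷ vertices) ≡ just t

module _ {a ℓ} {A : Set a} {R : Rel A ℓ} where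

  suffix : ∀ {s t u} (p : SimplePath R s u) → t ∈ₗ s ∷ SimplePath.vertices p → SimplePath R t u
  suffix p (here refl) = p
  suffix (path (_ ∷ vs) (_ ∷ lk) (_ ∷ un) e) (there t∈vs) = suffix (path vs lk un e) t∈vs

  star⇒simplePath : DecidableEquality A → ∀ {s t} → Star R s t → SimplePath R s t
  star⇒simplePath _≟ᴬ_ ε = path [] [-] (All.[] ∷ []) refl
  star⇒simplePath _≟ᴬ_ {s} (r ◅ w) with star⇒simplePath _≟ᴬ_ w
  ... | p@(path vs lk un e) with DecMembership._∈?_ _≟ᴬ_ s (_ ∷ vs)
  ... | yes s∈p = suffix p s∈p
  ... | no  s∉p = path (_ ∷ vs) (r ∷ lk) (¬Any⇒All¬ _ s∉p ∷ un) e

last-∷ʳ : ∀ {a} {A : Set a} (s : A) vs t → last (s ∷ vs ∷ʳ t) ≡ just t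
last-∷ʳ s []       t = refl
last-∷ʳ s (v ∷ vs) t = last-∷ʳ v vs t

module _ {m : ℕ} (T : Graph m) where

  AvoidingEdge : Fin m → Fin m → Rel (Fin m) Level.zero
  AvoidingEdge t₁ t₂ s u = Adj T s u × ¬ (s ≡ t₁ × u ≡ t₂) × ¬ (s ≡ t₂ × u ≡ t₁)

  -- The loop-erased walk from t₁ to t₂, closed up by the edge t₂t₁, is a cycle unless it
  -- is the edge t₁t₂ itself, which it avoids.
  acyclic⇒bridge : ∀ {t₁ t₂} → ¬ HasCycle T → Adj T t₁ t₂ → ¬ Star (AvoidingEdge t₁ t₂) t₁ t₂
  acyclic⇒bridge {t₁} {t₂} acyclic t₁t₂ w with star⇒simplePath _≟_ w
  ... | path vs lk un e with initLast vs
  ... | [] = irrefl T (subst (Adj T t₁) (≡-sym (just-injective e)) t₁t₂)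
  ... | us ∷ʳ′ u with just-injective (trans (≡-sym (last-∷ʳ t₁ us u)) e)
  ... | refl = cycle-or-edge us lk un
    where
    cycle-or-edge : ∀ us → Linked (AvoidingEdge t₁ u) (t₁ ∷ us ∷ʳ u) → Unique (t₁ ∷ us ∷ʳ u) → ⊥
    cycle-or-edge []       ((_ , t₁t₂-avoided , _) ∷ _) _ = t₁t₂-avoided (refl , refl)
    cycle-or-edge (v ∷ us) lk un =
      acyclic (t₁ , u , v ∷ us , s≤s z≤n , un , Linked.map proj₁ lk , Graph.sym T t₁t₂)

  walk-source : ∀ {S : Pred (Fin m) Level.zero} {s t} → Walk T S s t → S s
  walk-source (here Ss)     = Ss
  walk-source (step Ss _ _) = Ss

  walk⇒star : ∀ {ℓ} {S : Pred (Fin m) Level.zero} {R : Rel (Fin m) ℓ} →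
    (∀ {s u} → S s → S u → Adj T s u → R s u) → ∀ {s t} → Walk T S s t → Star R s t
  walk⇒star inS⇒R (here _)      = ε
  walk⇒star inS⇒R (step Ss a w) = inS⇒R Ss (walk-source w) a ◅ walk⇒star inS⇒R w

  avoidingEdge-outside : ∀ {S : Pred (Fin m) Level.zero} {t₁ t₂ s u} → ¬ S t₁ ⊎ ¬ S t₂ →
    S s → S u → Adj T s u → AvoidingEdge t₁ t₂ s u
  avoidingEdge-outside (inj₁ t₁∉S) Ss Su a = a , (λ { (refl , _) → t₁∉S Ss }) , (λ { (_ , refl) → t₁∉S Su })
  avoidingEdge-outside (inj₂ t₂∉S) Ss Su a = a , (λ { (_ , refl) → t₂∉S Su }) , (λ { (refl , _) → t₂∉S Ss })

  module SidesOfBridge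
    (acyclic : ¬ HasCycle T) {t₁ t₂ : Fin m} (t₁t₂ : Adj T t₁ t₂)
    {P Q : Pred (Fin m) Level.zero}
    (P-connected : InducesConnected T P) (t₁∈P : P t₁) (t₂∉P : ¬ P t₂)
    (Q-connected : InducesConnected T Q) (t₂∈Q : Q t₂) (t₁∉Q : ¬ Q t₁) where

    from-t₁ : ∀ {s} → P s → Star (AvoidingEdge t₁ t₂) t₁ s
    from-t₁ {s} s∈P = walk⇒star (avoidingEdge-outside (inj₂ t₂∉P)) (P-connected t₁ s t₁∈P s∈P)

    to-t₂ : ∀ {u} → Q u → Star (AvoidingEdge t₁ t₂) u t₂
    to-t₂ {u} u∈Q = walk⇒star (avoidingEdge-outside (inj₁ t₁∉Q)) (Q-connected u t₂ u∈Q t₂∈Q)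

    only-link : ∀ {s u} → P s → Q u → s ≡ u ⊎ Adj T s u → s ≡ t₁ × u ≡ t₂
    only-link s∈P s∈Q (inj₁ refl) = ⊥-elim (acyclic⇒bridge acyclic t₁t₂ (from-t₁ s∈P ◅◅ to-t₂ s∈Q))
    only-link {s} {u} s∈P u∈Q (inj₂ su) with s ≟ t₁ | u ≟ t₂
    ... | yes s≡t₁ | yes u≡t₂ = s≡t₁ , u≡t₂
    ... | no s≢t₁  | _ = ⊥-elim (acyclic⇒bridge acyclic t₁t₂ (from-t₁ s∈P ◅◅ avoided ◅ to-t₂ u∈Q))
      where
      avoided : AvoidingEdge t₁ t₂ s u
      avoided = su , (λ { (s≡t₁ , _) → s≢t₁ s≡t₁ }) , (λ { (refl , _) → t₂∉P s∈P })
    ... | yes refl | no u≢t₂ = ⊥-elim (acyclic⇒bridge acyclic t₁t₂ (from-t₁ s∈P ◅◅ avoided ◅ to-t₂ u∈Q))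
      where
      avoided : AvoidingEdge t₁ t₂ t₁ u
      avoided = su , (λ { (_ , u≡t₂) → u≢t₂ u≡t₂ }) , (λ { (_ , refl) → t₁∉Q u∈Q })

Separated : ∀ {n} → Subset n → Subset n → Fin n → Fin n → Set
Separated A B x y = x ∈ A × x ∉ B × y ∈ B × y ∉ A

module _ {n : ℕ} (G : Graph n) where

  crossEdge⇒separated : ∀ {A B x y} → CrossEdge G A B x y → Separated A B x y ⊎ Separated A B y x
  crossEdge⇒separated {A} {B} (_ , x∈A∪B , y∈A∪B , ¬A , ¬B) with x∈p∪q⁻ A B x∈A∪B | x∈p∪q⁻ A B y∈A∪B
  ... | inj₁ x∈A | inj₁ y∈A = ⊥-elim (¬A (x∈A , y∈A))
  ... | inj₁ x∈A | inj₂ y∈B = inj₁ (x∈A , (λ x∈B → ¬B (x∈B , y∈B)) , y∈B , (λ y∈A → ¬A (x∈A , y∈A)))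
  ... | inj₂ x∈B | inj₁ y∈A = inj₂ (y∈A , (λ y∈B → ¬B (x∈B , y∈B)) , x∈B , (λ x∈A → ¬A (x∈A , y∈A)))
  ... | inj₂ x∈B | inj₂ y∈B = ⊥-elim (¬B (x∈B , y∈B))

  separated⇒crossEdge : ∀ {A B x y} → Adj G x y → Separated A B x y → CrossEdge G A B x y
  separated⇒crossEdge xy (x∈A , x∉B , y∈B , y∉A) =
    xy , x∈p∪q⁺ (inj₁ x∈A) , x∈p∪q⁺ (inj₂ y∈B) , y∉A ∘ proj₂ , x∉B ∘ proj₁

  crossEdge-sym : ∀ {A B x y} → CrossEdge G A B x y → CrossEdge G A B y x
  crossEdge-sym (xy , x∈A∪B , y∈A∪B , ¬A , ¬B) = Graph.sym G xy , y∈A∪B , x∈A∪B , ¬A ∘ swap , ¬B ∘ swap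

∪-mono-⊆ : ∀ {n} {A A′ B B′ : Subset n} → A ⊆ A′ → B ⊆ B′ → A ∪ B ⊆ A′ ∪ B′
∪-mono-⊆ {A = A} {B = B} A⊆A′ B⊆B′ x∈A∪B with x∈p∪q⁻ A B x∈A∪B
... | inj₁ x∈A = x∈p∪q⁺ (inj₁ (A⊆A′ x∈A))
... | inj₂ x∈B = x∈p∪q⁺ (inj₂ (B⊆B′ x∈B))

module Enlargement {n m : ℕ} {G : Graph n} {T : Graph m} {χ χ' : Fin m → Subset n}
  (td : IsLooseTD G T χ)
  (χ'-connected : ∀ x → InducesConnected T (λ t → x ∈ χ' t))
  (χ⊆χ' : ∀ x t → x ∈ χ t → x ∈ χ' t) where
  open IsLooseTD td

  L2-witness : ∀ {x y} → Adj G x y → ∃[ s ] ∃[ u ] x ∈ χ s × y ∈ χ u × (s ≡ u ⊎ Adj T s u)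
  L2-witness {x} {y} xy with L2 x y xy
  ... | s₁ , s₂ , s₁s₂ , x∈ , y∈ with x∈p∪q⁻ (χ s₁) (χ s₂) x∈ | x∈p∪q⁻ (χ s₁) (χ s₂) y∈
  ... | inj₁ x∈₁ | inj₁ y∈₁ = s₁ , s₁ , x∈₁ , y∈₁ , inj₁ refl
  ... | inj₁ x∈₁ | inj₂ y∈₂ = s₁ , s₂ , x∈₁ , y∈₂ , inj₂ s₁s₂
  ... | inj₂ x∈₂ | inj₁ y∈₁ = s₂ , s₁ , x∈₂ , y∈₁ , inj₂ (Graph.sym T s₁s₂)
  ... | inj₂ x∈₂ | inj₂ y∈₂ = s₂ , s₂ , x∈₂ , y∈₂ , inj₁ refl

  separated-shrinks : ∀ {t₁ t₂ x y} → Adj T t₁ t₂ → Adj G x y →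
    Separated (χ' t₁) (χ' t₂) x y → Separated (χ t₁) (χ t₂) x y
  separated-shrinks {t₁} {t₂} {x} {y} t₁t₂ xy (x∈₁ , x∉₂ , y∈₂ , y∉₁)
    with L2-witness xy
  ... | s , u , x∈s , y∈u , s~u with only-link (χ⊆χ' x s x∈s) (χ⊆χ' y u y∈u) s~u
    where
    open SidesOfBridge T (IsTree.acyclic tree) t₁t₂
      (χ'-connected x) x∈₁ x∉₂ (χ'-connected y) y∈₂ y∉₁
  ... | refl , refl = x∈s , x∉₂ ∘ χ⊆χ' x t₂ , y∈u , y∉₁ ∘ χ⊆χ' y t₁

  crossEdge-shrinks : ∀ {t₁ t₂ x y} → Adj T t₁ t₂ →
    CrossEdge G (χ' t₁) (χ' t₂) x y → CrossEdge G (χ t₁) (χ t₂) x y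
  crossEdge-shrinks t₁t₂ c@(xy , _) with crossEdge⇒separated G c
  ... | inj₁ sep = separated⇒crossEdge G xy (separated-shrinks t₁t₂ xy sep)
  ... | inj₂ sep = crossEdge-sym G
          (separated⇒crossEdge G (Graph.sym G xy) (separated-shrinks t₁t₂ (Graph.sym G xy) sep))

lemma13 : ∀ {n m} (G : Graph n) (T : Graph m) (χ χ' : Fin m → Subset n) →
    IsLooseTD G T χ →
    (∀ x → InducesConnected T (λ t → x ∈ χ' t)) →
    (∀ x t → x ∈ χ t → x ∈ χ' t) →
    IsLooseTD G T χ'
lemma13 G T χ χ' td χ'-connected χ⊆χ' = record
  { tree         = tree
  ; L1-nonempty  = λ x → let t , x∈t = L1-nonempty x in t , χ⊆χ' x t x∈t
  ; L1-connected = χ'-connected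
  ; L2           = λ x y xy → let t₁ , t₂ , t₁t₂ , x∈ , y∈ = L2 x y xy in
                     t₁ , t₂ , t₁t₂ , ∪-mono-⊆ (χ⊆χ' _ t₁) (χ⊆χ' _ t₂) x∈ , ∪-mono-⊆ (χ⊆χ' _ t₁) (χ⊆χ' _ t₂) y∈
  ; L3           = λ t₁ t₂ t₁t₂ x y x' y' c c' →
                     L3 t₁ t₂ t₁t₂ x y x' y' (crossEdge-shrinks t₁t₂ c) (crossEdge-shrinks t₁t₂ c')
  }
  where
  open IsLooseTD td
  open Enlargement td χ'-connected χ⊆χ'
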